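{- Let $G$ be a graph with $n$ vertices and minimum degree $\delta(G)\geq \frac{2}{3}n-1$. Then $\pi^*_2(G)=\pi^*(G)$.
   Context: All graphs are finite and simple; $\delta(G)$ denotes the minimum degree. A pebble distribution on a graph $G$ is a function $D:V(G)\to\mathbb{Z}_{\geq 0}$; its size is $|D|=\sum_v D(v)$. A pebbling move removes two pebbles from a vertex having at least two pebbles and places one pebble on an adjacent vertex. A vertex is reachable under $D$ if some sequence of pebbling moves, each applied to a vertex having at least two pebbles at that time, results in at least one pebble on it. $D$ is solvable if every vertex is reachable. $\pi^*(G)$ is the minimum size of a solvable distribution. A distribution is $2$-restricted if $D(v)\leq 2$ for all $v$; $\pi^*_2(G)$ is the minimum size of a solvable $2$-restricted distribution. -}

module Defs where

open import Data.Nat using (ℕ; zero; suc; _+_; _*_; _∸_; _≤_)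
open import Data.Bool using (Bool; true; false; if_then_else_)
open import Data.Fin using (Fin; _≟_)
open import Data.Vec using (tabulate; sum; countᵇ)
open import Data.Product using (Σ; _×_; ∃; ∃-syntax)
open import Relation.Nullary using (does)
open import Relation.Binary.PropositionalEquality using (_≡_)
open import Relation.Binary.Construct.Closure.ReflexiveTransitive using (Star)

record Graph (n : ℕ) : Set where
  field
    adj   : Fin n → Fin n → Bool
    sym   : ∀ u v → adj u v ≡ adj v u
    irrefl : ∀ v → adj v v ≡ false
open Graph public

deg : ∀ {n} → Graph n → Fin n → ℕ
deg G v = countᵇ (adj G v) (tabulate (λ w → w))

Dist : ℕ → Set
Dist n = Fin n → ℕ

size : ∀ {n} → Dist n → ℕ
size D = sum (tabulate D)

move : ∀ {n} → Dist n → Fin n → Fin n → Dist n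
move D u v w =
  if does (w ≟ u) then D u ∸ 2
  else (if does (w ≟ v) then suc (D v) else D w)

data Step {n} (G : Graph n) (D : Dist n) : Dist n → Set where
  step : ∀ u v → adj G u v ≡ true → 2 ≤ D u → Step G D (move D u v)

Moves : ∀ {n} → Graph n → Dist n → Dist n → Set
Moves G = Star (Step G)

Reachable : ∀ {n} → Graph n → Dist n → Fin n → Set
Reachable G D v = ∃[ D' ] (Moves G D D' × 1 ≤ D' v)

Solvable : ∀ {n} → Graph n → Dist n → Set
Solvable G D = ∀ v → Reachable G D v

TwoRestricted : ∀ {n} → Dist n → Set
TwoRestricted D = ∀ v → D v ≤ 2

IsPiStar : ∀ {n} → Graph n → ℕ → Set
IsPiStar G k =
  (∃[ D ] (Solvable G D × size D ≡ k)) ×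
  (∀ D → Solvable G D → k ≤ size D)

IsPiStar2 : ∀ {n} → Graph n → ℕ → Set
IsPiStar2 G k =
  (∃[ D ] (TwoRestricted D × Solvable G D × size D ≡ k)) ×
  (∀ D → TwoRestricted D → Solvable G D → k ≤ size D)

{-# OPTIONS --safe #-}

-- A solvable distribution with at most three pebbles is of one of three kinds. If no vertex
-- holds two pebbles, nothing can move, so every vertex is occupied and there are n pebbles.
-- If all pebbles sit on one vertex u, at most one move is possible, so u dominates G and two
-- pebbles on u already solve it. Otherwise there are two pebbles on u and one on w, and the
-- reachable vertices are exactly those reachable from the 2-restricted distribution 2u + w.
-- Beyond three pebbles, the degree bound forces any three pairwise non-adjacent vertices to
-- have a common neighbour, so two pebbles on each of two non-adjacent vertices solve G.
-- Thus π*(G) ≤ 4, and the optimum is attained by one of the 2-restricted distributions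
-- 1ⁿ, 2u, 2u + w, 2u + 2w.

module Submission where

open import Data.Bool using (Bool; true; false; if_then_else_)
import Data.Bool as Bool
import Data.Sum as Sum
open import Data.Bool.Properties using (¬-not)
open import Data.Empty using (⊥; ⊥-elim)
open import Data.Fin using (Fin; zero; suc; _≟_; punchOut)
open import Data.Fin.Properties
  using (any?; all?; ¬∀⟶∃¬; punchIn-punchOut; punchOut-injective)
open import Data.Nat using (ℕ; zero; suc; _+_; _*_; _∸_; _≤_; _⊓_; z≤n; s≤s; _≤?_)
open import Data.Nat.Properties hiding (_≟_)
open import Algebra.Properties.CommutativeMonoid.Sum +-0-commutativeMonoid
  using (sum-remove; ∑-distrib-+) renaming (sum to ∑)
open import Data.Nat.Solver using (module +-*-Solver)
open import Data.Product using (_×_; _,_; proj₂; ∃; ∃₂; ∃-syntax)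
open import Data.Sum using (_⊎_; inj₁; inj₂)
open import Data.Vec using (tabulate; countᵇ)
open import Data.Vec.Functional using (removeAt)
open import Function using (_∘_)
open import Relation.Binary.Construct.Closure.ReflexiveTransitive using (ε; _◅_)
open import Relation.Binary.PropositionalEquality
open import Relation.Nullary using (Dec; yes; no; ¬_; does; contradiction)
open import Relation.Nullary.Decidable
  using (_×-dec_; _⊎-dec_; ¬?; dec-true; dec-false; decidable-stable)

open import Defs hiding (sym)

private
  variable
    n k l : ℕ
    G : Graph n
    D : Dist n
    u v w x : Fin n

infixl 6 _⊕_

_⊕_ : Dist n → Dist n → Dist n
(D ⊕ E) y = D y + E y

single : Fin n → ℕ → Dist n
single a k y = if does (y ≟ a) then k else 0

pair : Fin n → ℕ → Fin n → ℕ → Dist n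
pair u k w l = single u k ⊕ single w l

indicator : Bool → ℕ
indicator b = if b then 1 else 0

ClosedNbhd : Graph n → Fin n → Fin n → Set
ClosedNbhd G u v = v ≡ u ⊎ adj G u v ≡ true

Dominating : Graph n → Fin n → Set
Dominating G u = ∀ v → ClosedNbhd G u v

-- The vertices reachable from two pebbles on u and one pebble on w.
Reach₂₁ : Graph n → Fin n → Fin n → Fin n → Set
Reach₂₁ G u w v = ClosedNbhd G u v ⊎ v ≡ w ⊎ (adj G u w ≡ true × adj G w v ≡ true)

Dominating₂₁ : Graph n → Fin n → Fin n → Set
Dominating₂₁ G u w = w ≢ u × ∀ v → Reach₂₁ G u w v

RestrictedSolution : Graph n → ℕ → Set
RestrictedSolution G k = ∃[ D ] (TwoRestricted D × Solvable G D × size D ≡ k)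

adjacent⇒≢ : (G : Graph n) → adj G u v ≡ true → v ≢ u
adjacent⇒≢ {u = u} G uv refl = contradiction (trans (sym uv) (irrefl G u)) λ ()

closedNbhd? : ∀ {n} (G : Graph n) u v → Dec (ClosedNbhd G u v)
closedNbhd? G u v = v ≟ u ⊎-dec adj G u v Bool.≟ true

far⇒≢ : (G : Graph n) → ¬ ClosedNbhd G u v → u ≢ v
far⇒≢ G ¬uv u≡v = ¬uv (inj₁ (sym u≡v))

far⇒nonadjacent : (G : Graph n) → ¬ ClosedNbhd G u v → adj G u v ≡ false
far⇒nonadjacent G ¬uv = ¬-not (¬uv ∘ inj₂)

far⇒nonadjacent′ : ∀ {n} (G : Graph n) {u v} → ¬ ClosedNbhd G u v → adj G v u ≡ false
far⇒nonadjacent′ G {u} {v} ¬uv = trans (Graph.sym G v u) (far⇒nonadjacent G ¬uv)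

dominating? : ∀ {n} (G : Graph n) → Dec (∃ (Dominating G))
dominating? G = any? λ u → all? (closedNbhd? G u)

dominating₂₁? : ∀ {n} (G : Graph n) → Dec (∃₂ (Dominating₂₁ G))
dominating₂₁? G = any? λ u → any? λ w → ¬? (w ≟ u) ×-dec all? λ v →
  closedNbhd? G u v ⊎-dec v ≟ w ⊎-dec adj G u w Bool.≟ true ×-dec adj G w v Bool.≟ true

far-vertex : ∀ {n} (G : Graph n) → ¬ ∃ (Dominating G) → (u : Fin n) → ∃ λ w → ¬ ClosedNbhd G u w
far-vertex G ¬dom u = ¬∀⟶∃¬ _ (ClosedNbhd G u) (closedNbhd? G u) (λ dom → ¬dom (u , dom))

size≡∑ : (D : Dist n) → size D ≡ ∑ D
size≡∑ {zero}  D = refl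
size≡∑ {suc n} D = cong (D zero +_) (size≡∑ (D ∘ suc))

size-mono-≤ : {D E : Dist n} → (∀ y → D y ≤ E y) → size D ≤ size E
size-mono-≤ {zero}  _   = z≤n
size-mono-≤ {suc n} D≤E = +-mono-≤ (D≤E zero) (size-mono-≤ (D≤E ∘ suc))

size-const : ∀ n k → size {n} (λ _ → k) ≡ n * k
size-const zero    k = refl
size-const (suc n) k = cong (k +_) (size-const n k)

size-⊕ : (D E : Dist n) → size (D ⊕ E) ≡ size D + size E
size-⊕ D E = begin
  size (D ⊕ E)     ≡⟨ size≡∑ (D ⊕ E) ⟩
  ∑ (D ⊕ E)        ≡⟨ ∑-distrib-+ D E ⟩
  ∑ D + ∑ E        ≡⟨ cong₂ _+_ (size≡∑ D) (size≡∑ E) ⟨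
  size D + size E  ∎
  where open ≡-Reasoning

size-removeAt : (D : Dist (suc n)) (i : Fin (suc n)) → size D ≡ D i + size (removeAt D i)
size-removeAt D i = begin
  size D                      ≡⟨ size≡∑ D ⟩
  ∑ D                         ≡⟨ sum-remove D ⟩
  D i + ∑ (removeAt D i)      ≡⟨ cong (D i +_) (size≡∑ (removeAt D i)) ⟨
  D i + size (removeAt D i)   ∎
  where open ≡-Reasoning

≤-size : (D : Dist n) (i : Fin n) → D i ≤ size D
≤-size {suc n} D i = begin
  D i                        ≤⟨ m≤m+n (D i) _ ⟩
  D i + size (removeAt D i)  ≡⟨ size-removeAt D i ⟨
  size D                     ∎
  where open ≤-Reasoning

≤-size-pair : (D : Dist n) {i j : Fin n} → i ≢ j → D i + D j ≤ size D
≤-size-pair {suc n} D {i} {j} i≢j = begin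
  D i + D j                          ≡⟨ cong (λ k → D i + D k) (punchIn-punchOut i≢j) ⟨
  D i + removeAt D i (punchOut i≢j)  ≤⟨ +-monoʳ-≤ (D i) (≤-size (removeAt D i) _) ⟩
  D i + size (removeAt D i)          ≡⟨ size-removeAt D i ⟨
  size D                             ∎
  where open ≤-Reasoning

≤-size-triple : (D : Dist n) {i j k : Fin n} → i ≢ j → i ≢ k → j ≢ k → D i + D j + D k ≤ size D
≤-size-triple {suc n} D {i} {j} {k} i≢j i≢k j≢k = begin
  D i + D j + D k       ≡⟨ +-assoc (D i) (D j) (D k) ⟩
  D i + (D j + D k)     ≡⟨ cong₂ (λ a b → D i + (D a + D b)) (punchIn-punchOut i≢j) (punchIn-punchOut i≢k) ⟨
  D i + (removeAt D i (punchOut i≢j) + removeAt D i (punchOut i≢k))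
    ≤⟨ +-monoʳ-≤ (D i) (≤-size-pair (removeAt D i) (j≢k ∘ punchOut-injective i≢j i≢k)) ⟩
  D i + size (removeAt D i)
    ≡⟨ size-removeAt D i ⟨
  size D
    ∎
  where open ≤-Reasoning

single-self : (a : Fin n) (k : ℕ) → single a k a ≡ k
single-self a k rewrite dec-true (a ≟ a) refl = refl

single-other : {a y : Fin n} → y ≢ a → single a k y ≡ 0
single-other {a = a} {y} y≢a rewrite dec-false (y ≟ a) y≢a = refl

size-single : (a : Fin n) (k : ℕ) → size (single a k) ≡ k
size-single {suc n} zero    k = trans (cong (k +_) (trans (size-const n 0) (*-zeroʳ n))) (+-identityʳ k)
size-single {suc n} (suc a) k = size-single a k

pair-first : w ≢ u → pair u k w l u ≡ k
pair-first {u = u} {k = k} w≢u = trans (cong₂ _+_ (single-self u k) (single-other (w≢u ∘ sym))) (+-identityʳ k)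

pair-second : w ≢ u → pair u k w l w ≡ l
pair-second {w = w} {l = l} w≢u = cong₂ _+_ (single-other w≢u) (single-self w l)

size-pair : (u : Fin n) (k : ℕ) (w : Fin n) (l : ℕ) → size (pair u k w l) ≡ k + l
size-pair u k w l = trans (size-⊕ (single u k) (single w l)) (cong₂ _+_ (size-single u k) (size-single w l))

twoRestricted-single : k ≤ 2 → TwoRestricted (single u k)
twoRestricted-single {u = u} k≤2 y with y ≟ u
... | yes _ = k≤2
... | no  _ = z≤n

twoRestricted-pair : w ≢ u → k ≤ 2 → l ≤ 2 → TwoRestricted (pair u k w l)
twoRestricted-pair {w = w} {u} {k} w≢u k≤2 l≤2 y with y ≟ u | y ≟ w
... | yes y≡u | yes y≡w = contradiction (trans (sym y≡w) y≡u) w≢u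
... | yes _   | no _    = ≤-trans (≤-reflexive (+-identityʳ k)) k≤2
... | no _    | yes _   = l≤2
... | no _    | no _    = z≤n

move-target : (D : Dist n) → v ≢ u → move D u v v ≡ suc (D v)
move-target {v = v} {u} D v≢u rewrite dec-false (v ≟ u) v≢u | dec-true (v ≟ v) refl = refl

move-other : (D : Dist n) → w ≢ u → w ≢ v → move D u v w ≡ D w
move-other {w = w} {u} {v} D w≢u w≢v rewrite dec-false (w ≟ u) w≢u | dec-false (w ≟ v) w≢v = refl

move-support : (D : Dist n) (u v w : Fin n) → 1 ≤ move D u v w → w ≡ u ⊎ w ≡ v ⊎ 1 ≤ D w
move-support D u v w 1≤ with w ≟ u | w ≟ v
... | yes w≡u | _       = inj₁ w≡u
... | no _    | yes w≡v = inj₂ (inj₁ w≡v)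
... | no _    | no _    = inj₂ (inj₂ 1≤)

move-≤1 : (D : Dist n) → x ≢ u → D u ≤ 3 → D x ≡ 0 → (∀ y → y ≢ u → D y ≤ 1) → ∀ y → move D u x y ≤ 1
move-≤1 {x = x} {u} D x≢u Du≤3 Dx≡0 D≤1 y with y ≟ u | y ≟ x
... | yes refl | _        = ∸-monoˡ-≤ 2 Du≤3
... | no _     | yes refl = ≤-reflexive (cong suc Dx≡0)
... | no y≢u   | no _     = D≤1 y y≢u

move-concentrates : (D : Dist n) → D u ≤ 2 → (∀ y → y ≢ u → y ≢ w → D y ≡ 0) → ∀ y → y ≢ w → move D u w y ≡ 0
move-concentrates {u = u} {w = w} D Du≤2 D≡0 y y≢w with y ≟ u | y ≟ w
... | yes refl | _       = m≤n⇒m∸n≡0 Du≤2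
... | no _     | yes y≡w = contradiction y≡w y≢w
... | no y≢u   | no _    = D≡0 y y≢u y≢w

nonzero⇒≡ : (∀ y → y ≢ u → D y ≡ 0) → 1 ≤ D v → v ≡ u
nonzero⇒≡ {u = u} {D = D} {v = v} D≡0 1≤Dv =
  decidable-stable (v ≟ u) λ v≢u → contradiction (subst (1 ≤_) (D≡0 v v≢u) 1≤Dv) λ ()

nonzero⇒≡⊎≡ : (∀ y → y ≢ u → y ≢ w → D y ≡ 0) → 1 ≤ D v → v ≡ u ⊎ v ≡ w
nonzero⇒≡⊎≡ {u = u} {w = w} {D = D} {v = v} D≡0 1≤Dv with v ≟ u | v ≟ w
... | yes v≡u | _       = inj₁ v≡u
... | no _    | yes v≡w = inj₂ v≡w
... | no v≢u  | no v≢w  = contradiction (subst (1 ≤_) (D≡0 v v≢u v≢w) 1≤Dv) λ ()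

reachable-here : 1 ≤ D v → Reachable G D v
reachable-here 1≤Dv = _ , ε , 1≤Dv

reachable-after : ∀ {D′} → Step G D D′ → Reachable G D′ v → Reachable G D v
reachable-after s (_ , ms , 1≤) = _ , s ◅ ms , 1≤

reachable-from-neighbour : adj G u v ≡ true → 2 ≤ D u → Reachable G D v
reachable-from-neighbour {G = G} {D = D} uv 2≤Du =
  reachable-after (step _ _ uv 2≤Du)
    (reachable-here (subst (1 ≤_) (sym (move-target D (adjacent⇒≢ G uv))) (s≤s z≤n)))

reachable-in-closedNbhd : ClosedNbhd G u v → 2 ≤ D u → Reachable G D v
reachable-in-closedNbhd (inj₁ refl) 2≤Du = reachable-here (≤-trans (s≤s z≤n) 2≤Du)
reachable-in-closedNbhd (inj₂ uv)   2≤Du = reachable-from-neighbour uv 2≤Du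

first-move : Reachable G D v →
  1 ≤ D v ⊎ ∃₂ λ a x → adj G a x ≡ true × 2 ≤ D a × Reachable G (move D a x) v
first-move (_ , ε , 1≤Dv)                   = inj₁ 1≤Dv
first-move (_ , step a x ax 2≤Da ◅ ms , 1≤) = inj₂ (a , x , ax , 2≤Da , _ , ms , 1≤)

reachable-stuck : (∀ y → D y ≤ 1) → Reachable G D v → 1 ≤ D v
reachable-stuck D≤1 (_ , ε , 1≤Dv)               = 1≤Dv
reachable-stuck D≤1 (_ , step a _ _ 2≤Da ◅ _ , _) = contradiction (≤-trans 2≤Da (D≤1 a)) (n≮n 1)

-- Solvable distributions with at most three pebbles

reachable-after-final-move : x ≢ u → D u ≤ 3 → D x ≡ 0 → (∀ y → y ≢ u → D y ≤ 1) →
  Reachable G (move D u x) v → v ≡ u ⊎ v ≡ x ⊎ 1 ≤ D v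
reachable-after-final-move {D = D} {v = v} x≢u Du≤3 Dx≡0 D≤1 r =
  move-support D _ _ v (reachable-stuck (move-≤1 D x≢u Du≤3 Dx≡0 D≤1) r)

reachable-from-single : D u ≤ 3 → (∀ y → y ≢ u → D y ≡ 0) → Reachable G D v → ClosedNbhd G u v
reachable-from-single {D = D} {G = G} Du≤3 D≡0 r with first-move r
... | inj₁ 1≤Dv = inj₁ (nonzero⇒≡ D≡0 1≤Dv)
... | inj₂ (a , x , ax , 2≤Da , r′) with nonzero⇒≡ D≡0 (≤-trans (s≤s z≤n) 2≤Da)
... | refl with reachable-after-final-move (adjacent⇒≢ G ax) Du≤3 (D≡0 x (adjacent⇒≢ G ax))
                  (λ y y≢a → subst (_≤ 1) (sym (D≡0 y y≢a)) z≤n) r′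
... | inj₁ v≡a         = inj₁ v≡a
... | inj₂ (inj₁ refl) = inj₂ ax
... | inj₂ (inj₂ 1≤Dv) = inj₁ (nonzero⇒≡ D≡0 1≤Dv)

occupied⇒reach₂₁ : (∀ y → y ≢ u → y ≢ w → D y ≡ 0) → 1 ≤ D v → Reach₂₁ G u w v
occupied⇒reach₂₁ D≡0 = Sum.map inj₁ inj₁ ∘ nonzero⇒≡⊎≡ D≡0

reachable-from-two-one : w ≢ u → D u ≤ 2 → D w ≤ 1 → (∀ y → y ≢ u → y ≢ w → D y ≡ 0) →
  Reachable G D v → Reach₂₁ G u w v
reachable-from-two-one {w = w} {D = D} {G = G} {v = v} w≢u Du≤2 Dw≤1 D≡0 r with first-move r
... | inj₁ 1≤Dv = occupied⇒reach₂₁ {G = G} D≡0 1≤Dv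
... | inj₂ (a , x , ax , 2≤Da , r′) with nonzero⇒≡⊎≡ D≡0 (≤-trans (s≤s z≤n) 2≤Da)
... | inj₂ refl = contradiction (≤-trans 2≤Da Dw≤1) (n≮n 1)
... | inj₁ refl with x ≟ w
... | yes refl = inj₂ (Sum.map₂ (ax ,_) (reachable-from-single Dw≤3 (move-concentrates D Du≤2 D≡0) r′))
  where Dw≤3 = ≤-trans (≤-reflexive (move-target D w≢u)) (s≤s (m≤n⇒m≤1+n Dw≤1))
... | no x≢w with reachable-after-final-move x≢a (m≤n⇒m≤1+n Du≤2) (D≡0 x x≢a x≢w) D≤1 r′
  where
  x≢a = adjacent⇒≢ G ax
  D≤1 : ∀ y → y ≢ a → D y ≤ 1
  D≤1 y y≢a with y ≟ w
  ... | yes refl = Dw≤1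
  ... | no y≢w   = subst (_≤ 1) (sym (D≡0 y y≢a y≢w)) z≤n
... | inj₁ v≡a         = inj₁ (inj₁ v≡a)
... | inj₂ (inj₁ refl) = inj₁ (inj₂ ax)
... | inj₂ (inj₂ 1≤Dv) = occupied⇒reach₂₁ {G = G} D≡0 1≤Dv

small-solvable-cases : ∀ {n} {G : Graph n} {D} → Solvable G D → size D ≤ 3 →
  n ≤ size D ⊎ (∃ (Dominating G) × 2 ≤ size D) ⊎ (∃₂ (Dominating₂₁ G) × 3 ≤ size D)
small-solvable-cases {n} {D = D} solvable size≤3 with any? (λ u → 2 ≤? D u)
... | no ¬2≤ = inj₁ (begin
  n                   ≡⟨ trans (size-const n 1) (*-identityʳ n) ⟨
  size {n} (λ _ → 1)  ≤⟨ size-mono-≤ (λ v → reachable-stuck D≤1 (solvable v)) ⟩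
  size D              ∎)
  where
  open ≤-Reasoning
  D≤1 : ∀ y → D y ≤ 1
  D≤1 y = ≤-pred (≰⇒> (λ 2≤Dy → ¬2≤ (y , 2≤Dy)))
... | yes (u , 2≤Du) with any? (λ w → ¬? (w ≟ u) ×-dec (1 ≤? D w))
... | yes (w , w≢u , 1≤Dw) =
  inj₂ (inj₂ ((u , w , w≢u , λ v → reachable-from-two-one w≢u Du≤2 Dw≤1 D≡0 (solvable v)) ,
              ≤-trans (+-mono-≤ 2≤Du 1≤Dw) (≤-size-pair D (w≢u ∘ sym))))
  where
  Du+Dw≤3 = ≤-trans (≤-size-pair D (w≢u ∘ sym)) size≤3
  Du≤2 : D u ≤ 2
  Du≤2 = +-cancelʳ-≤ 1 (D u) 2 (≤-trans (+-monoʳ-≤ (D u) 1≤Dw) Du+Dw≤3)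
  Dw≤1 : D w ≤ 1
  Dw≤1 = +-cancelˡ-≤ 2 (D w) 1 (≤-trans (+-monoˡ-≤ (D w) 2≤Du) Du+Dw≤3)
  D≡0 : ∀ y → y ≢ u → y ≢ w → D y ≡ 0
  D≡0 y y≢u y≢w = n≤0⇒n≡0 (+-cancelˡ-≤ 3 (D y) 0
    (≤-trans (+-monoˡ-≤ (D y) (+-mono-≤ 2≤Du 1≤Dw))
             (≤-trans (≤-size-triple D (w≢u ∘ sym) (y≢u ∘ sym) (y≢w ∘ sym)) size≤3)))
... | no ¬occupied =
  inj₂ (inj₁ ((u , λ v → reachable-from-single Du≤3 D≡0 (solvable v)) , ≤-trans 2≤Du (≤-size D u)))
  where
  Du≤3 = ≤-trans (≤-size D u) size≤3
  D≡0 : ∀ y → y ≢ u → D y ≡ 0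
  D≡0 y y≢u = n<1⇒n≡0 (≰⇒> λ 1≤Dy → ¬occupied (y , y≢u , 1≤Dy))

solvable-size-≥ : ∀ {n} (G : Graph n) m → m ≤ 4 → (∃ (Dominating G) → m ≤ 2) → (∃₂ (Dominating₂₁ G) → m ≤ 3) →
  ∀ D → Solvable G D → n ⊓ m ≤ size D
solvable-size-≥ {n} G m m≤4 dom⇒m≤2 dom₂₁⇒m≤3 D solvable with 4 ≤? size D
... | yes 4≤size = ≤-trans (m⊓n≤n n m) (≤-trans m≤4 4≤size)
... | no 4≰size with small-solvable-cases solvable (≤-pred (≰⇒> 4≰size))
... | inj₁ n≤size                   = ≤-trans (m⊓n≤m n m) n≤size
... | inj₂ (inj₁ (dom , 2≤size))   = ≤-trans (m⊓n≤n n m) (≤-trans (dom⇒m≤2 dom) 2≤size)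
... | inj₂ (inj₂ (dom₂₁ , 3≤size)) = ≤-trans (m⊓n≤n n m) (≤-trans (dom₂₁⇒m≤3 dom₂₁) 3≤size)

-- 2-restricted solutions

optimal-solution : ∀ {n} {G : Graph n} {k} → RestrictedSolution G k → (∀ D → Solvable G D → k ≤ size D) →
  ∃[ k ] (IsPiStar G k × IsPiStar2 G k)
optimal-solution {k = k} s@(D , _ , solvable , size≡k) k≤ =
  k , ((D , solvable , size≡k) , k≤) , (s , λ D _ → k≤ D)

ones-solution : ∀ {n} (G : Graph n) → RestrictedSolution G n
ones-solution {n} G =
  (λ _ → 1) , (λ _ → s≤s z≤n) , (λ _ → reachable-here ≤-refl) , trans (size-const n 1) (*-identityʳ n)

min-with-ones : ∀ {n} {G : Graph n} {m} → RestrictedSolution G m → (∀ D → Solvable G D → n ⊓ m ≤ size D) →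
  ∃[ k ] (IsPiStar G k × IsPiStar2 G k)
min-with-ones {n} {G} {m} s n⊓m≤ with n ≤? m
... | yes n≤m = optimal-solution (ones-solution G) λ D solvable → subst (_≤ size D) (m≤n⇒m⊓n≡m n≤m) (n⊓m≤ D solvable)
... | no  n≰m = optimal-solution s λ D solvable → subst (_≤ size D) (m≥n⇒m⊓n≡n (≰⇒≥ n≰m)) (n⊓m≤ D solvable)

dominating-solution : Dominating G u → RestrictedSolution G 2
dominating-solution {u = u} dom =
  single u 2 , twoRestricted-single ≤-refl ,
  (λ v → reachable-in-closedNbhd (dom v) (≤-reflexive (sym (single-self u 2)))) , size-single u 2

twoOne-solution : Dominating₂₁ G u w → RestrictedSolution G 3
twoOne-solution {u = u} {w = w} (w≢u , reach) =
  pair u 2 w 1 , twoRestricted-pair w≢u ≤-refl (s≤s z≤n) , solvable , size-pair u 2 w 1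
  where
  2≤u : 2 ≤ pair u 2 w 1 u
  2≤u = ≤-reflexive (sym (pair-first w≢u))
  2≤w-after-move : 2 ≤ move (pair u 2 w 1) u w w
  2≤w-after-move = ≤-reflexive (sym (trans (move-target (pair u 2 w 1) w≢u) (cong suc (pair-second {k = 2} w≢u))))
  solvable : Solvable _ (pair u 2 w 1)
  solvable v with reach v
  ... | inj₁ near-u           = reachable-in-closedNbhd near-u 2≤u
  ... | inj₂ (inj₁ refl)      = reachable-here (≤-reflexive (sym (pair-second w≢u)))
  ... | inj₂ (inj₂ (uw , wv)) = reachable-after (step u w uw 2≤u) (reachable-from-neighbour wv 2≤w-after-move)

-- Three pairwise far vertices have a common neighbour

indicator-≤1 : ∀ b → indicator b ≤ 1
indicator-≤1 true  = ≤-refl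
indicator-≤1 false = z≤n

indicator-sum-≤2 : ∀ a b c → ¬ (a ≡ true × b ≡ true × c ≡ true) → indicator a + indicator b + indicator c ≤ 2
indicator-sum-≤2 true  true  true  ¬all = contradiction (refl , refl , refl) ¬all
indicator-sum-≤2 true  true  false _    = ≤-refl
indicator-sum-≤2 true  false c     _    = s≤s (indicator-≤1 c)
indicator-sum-≤2 false b     c     _    = +-mono-≤ (indicator-≤1 b) (indicator-≤1 c)

countᵇ-tabulate : ∀ {n} {A : Set} (p : A → Bool) (f : Fin n → A) → countᵇ p (tabulate f) ≡ size (indicator ∘ p ∘ f)
countᵇ-tabulate {zero}  p f = refl
countᵇ-tabulate {suc n} p f with p (f zero)
... | true  = cong suc (countᵇ-tabulate p (f ∘ suc))
... | false = countᵇ-tabulate p (f ∘ suc)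

deg≡size : (G : Graph n) (v : Fin n) → deg G v ≡ size (indicator ∘ adj G v)
deg≡size G v = countᵇ-tabulate (adj G v) (λ w → w)

-- No vertex is adjacent to all of u, w, x, so F ≤ 2 everywhere, while the slack 2 ∸ F
-- equals 2 at each of u, w and x.
degree-sum-bound : ∀ {n} (G : Graph n) {u w x} → ¬ ClosedNbhd G u w → ¬ ClosedNbhd G u x → ¬ ClosedNbhd G w x →
  ¬ (∃ λ c → adj G u c ≡ true × adj G w c ≡ true × adj G x c ≡ true) →
  deg G u + deg G w + deg G x + 6 ≤ n * 2
degree-sum-bound {n} G {u} {w} {x} ¬uw ¬ux ¬wx ¬common = begin
  deg G u + deg G w + deg G x + 6  ≡⟨ cong (_+ 6) degrees≡size ⟩
  size F + (2 + 2 + 2)             ≤⟨ +-monoʳ-≤ (size F) slack ⟩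
  size F + size S                  ≡⟨ size-⊕ F S ⟨
  size (F ⊕ S)                     ≤⟨ size-mono-≤ (λ c → ≤-reflexive (m+[n∸m]≡n (F≤2 c))) ⟩
  size {n} (λ _ → 2)               ≡⟨ size-const n 2 ⟩
  n * 2                            ∎
  where
  open ≤-Reasoning
  nbr : Fin n → Dist n
  nbr v = indicator ∘ adj G v
  F : Dist n
  F = nbr u ⊕ nbr w ⊕ nbr x
  S : Dist n
  S c = 2 ∸ F c
  F≤2 : ∀ c → F c ≤ 2
  F≤2 c = indicator-sum-≤2 _ _ _ (λ all → ¬common (c , all))
  degrees≡size : deg G u + deg G w + deg G x ≡ size F
  degrees≡size = sym (begin-equality
    size F                                 ≡⟨ size-⊕ (nbr u ⊕ nbr w) (nbr x) ⟩
    size (nbr u ⊕ nbr w) + size (nbr x)    ≡⟨ cong (_+ size (nbr x)) (size-⊕ (nbr u) (nbr w)) ⟩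
    size (nbr u) + size (nbr w) + size (nbr x)
      ≡⟨ cong₂ _+_ (cong₂ _+_ (deg≡size G u) (deg≡size G w)) (deg≡size G x) ⟨
    deg G u + deg G w + deg G x  ∎)
  S≡2 : ∀ {c} → adj G u c ≡ false → adj G w c ≡ false → adj G x c ≡ false → S c ≡ 2
  S≡2 uc wc xc rewrite uc | wc | xc = refl
  slack : 2 + 2 + 2 ≤ size S
  slack = subst (_≤ size S)
    (cong₂ _+_ (cong₂ _+_ (S≡2 (irrefl G u) (far⇒nonadjacent′ G ¬uw) (far⇒nonadjacent′ G ¬ux))
                          (S≡2 (far⇒nonadjacent G ¬uw) (irrefl G w) (far⇒nonadjacent′ G ¬wx)))
               (S≡2 (far⇒nonadjacent G ¬ux) (far⇒nonadjacent G ¬wx) (irrefl G x)))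
    (≤-size-triple S (far⇒≢ G ¬uw) (far⇒≢ G ¬ux) (far⇒≢ G ¬wx))

degree-bound-contradiction : ∀ n a b c → a + b + c + 6 ≤ n * 2 →
  2 * n ≤ 3 * a + 3 → 2 * n ≤ 3 * b + 3 → 2 * n ≤ 3 * c + 3 → ⊥
-- T (18 ≤ᵇ 9) reduces to ⊥.
degree-bound-contradiction n a b c sum≤ a≥ b≥ c≥ = ≤⇒≤ᵇ (+-cancelˡ-≤ (3 * (a + b + c)) 18 9 (begin
  3 * (a + b + c) + 18                   ≡⟨ solve 3 (λ a b c → con 3 :* (a :+ b :+ c) :+ con 18 := con 3 :* (a :+ b :+ c :+ con 6)) refl a b c ⟩
  3 * (a + b + c + 6)                    ≤⟨ *-monoʳ-≤ 3 sum≤ ⟩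
  3 * (n * 2)                            ≡⟨ solve 1 (λ n → con 3 :* (n :* con 2) := con 2 :* n :+ con 2 :* n :+ con 2 :* n) refl n ⟩
  2 * n + 2 * n + 2 * n                  ≤⟨ +-mono-≤ (+-mono-≤ a≥ b≥) c≥ ⟩
  3 * a + 3 + (3 * b + 3) + (3 * c + 3)  ≡⟨ solve 3 (λ a b c → con 3 :* a :+ con 3 :+ (con 3 :* b :+ con 3) :+ (con 3 :* c :+ con 3) := con 3 :* (a :+ b :+ c) :+ con 9) refl a b c ⟩
  3 * (a + b + c) + 9                    ∎))
  where
  open ≤-Reasoning
  open +-*-Solver

common-neighbour : ∀ {n} {G : Graph n} → (∀ v → 2 * n ≤ 3 * deg G v + 3) →
  ∀ {u w x} → ¬ ClosedNbhd G u w → ¬ ClosedNbhd G u x → ¬ ClosedNbhd G w x →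
  ∃ λ c → adj G u c ≡ true × adj G w c ≡ true × adj G x c ≡ true
common-neighbour {n} {G} δ-bound {u} {w} {x} ¬uw ¬ux ¬wx =
  decidable-stable (any? λ c → adj G u c Bool.≟ true ×-dec adj G w c Bool.≟ true ×-dec adj G x c Bool.≟ true)
    λ ¬common → degree-bound-contradiction n (deg G u) (deg G w) (deg G x) (degree-sum-bound G ¬uw ¬ux ¬wx ¬common)
                  (δ-bound u) (δ-bound w) (δ-bound x)

twoTwo-solution : ∀ {n} {G : Graph n} → (∀ v → 2 * n ≤ 3 * deg G v + 3) →
  ∀ {u w} → ¬ ClosedNbhd G u w → RestrictedSolution G 4
twoTwo-solution {G = G} δ-bound {u} {w} ¬uw =
  pair u 2 w 2 , twoRestricted-pair w≢u ≤-refl ≤-refl , solvable , size-pair u 2 w 2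
  where
  w≢u : w ≢ u
  w≢u = ¬uw ∘ inj₁
  2≤u : 2 ≤ pair u 2 w 2 u
  2≤u = ≤-reflexive (sym (pair-first w≢u))
  2≤w : 2 ≤ pair u 2 w 2 w
  2≤w = ≤-reflexive (sym (pair-second {k = 2} w≢u))
  solvable : Solvable G (pair u 2 w 2)
  solvable v with closedNbhd? G u v | closedNbhd? G w v
  ... | yes near-u | _          = reachable-in-closedNbhd near-u 2≤u
  ... | no _       | yes near-w = reachable-in-closedNbhd near-w 2≤w
  ... | no ¬uv     | no ¬wv     with common-neighbour {G = G} δ-bound ¬uw ¬uv ¬wv
  ... | c , uc , wc , vc =
    reachable-after (step u c uc 2≤u) (reachable-after (step w c wc 2≤w′) (reachable-from-neighbour cv 2≤c))
    where
    c≢u = adjacent⇒≢ G uc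
    c≢w = adjacent⇒≢ G wc
    cv : adj G c v ≡ true
    cv = trans (Graph.sym G c v) vc
    2≤w′ : 2 ≤ move (pair u 2 w 2) u c w
    2≤w′ = ≤-trans 2≤w (≤-reflexive (sym (move-other (pair u 2 w 2) w≢u (c≢w ∘ sym))))
    2≤c : 2 ≤ move (move (pair u 2 w 2) u c) w c c
    2≤c = ≤-trans (s≤s (s≤s z≤n)) (≤-reflexive (sym (begin-equality
      move (move (pair u 2 w 2) u c) w c c  ≡⟨ move-target (move (pair u 2 w 2) u c) c≢w ⟩
      suc (move (pair u 2 w 2) u c c)       ≡⟨ cong suc (move-target (pair u 2 w 2) c≢u) ⟩
      suc (suc (pair u 2 w 2 c))            ∎)))
      where open ≤-Reasoning

mainTheorem7 : (n : ℕ) (G : Graph n) →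
    (∀ v → 2 * n ≤ 3 * deg G v + 3) →
    ∃[ k ] (IsPiStar G k × IsPiStar2 G k)
mainTheorem7 zero G _ = optimal-solution (ones-solution G) (λ _ _ → z≤n)
mainTheorem7 (suc n) G δ-bound with dominating? G
... | yes (_ , dom) =
  min-with-ones (dominating-solution dom)
    (solvable-size-≥ G 2 (m≤m+n 2 2) (λ _ → ≤-refl) (λ _ → n≤1+n 2))
... | no ¬dom with dominating₂₁? G
... | yes (_ , _ , dom₂₁) =
  min-with-ones (twoOne-solution dom₂₁)
    (solvable-size-≥ G 3 (n≤1+n 3) (⊥-elim ∘ ¬dom) (λ _ → ≤-refl))
... | no ¬dom₂₁ =
  min-with-ones (twoTwo-solution δ-bound (proj₂ (far-vertex G ¬dom zero)))
    (solvable-size-≥ G 4 ≤-refl (⊥-elim ∘ ¬dom) (⊥-elim ∘ ¬dom₂₁))
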